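{- Let $(S,*)$ and $(T,*)$ be partial semigroups. (1) $S\times T$ is adequate if and only if $S$ and $T$ are adequate. (2) If $f$ is an adequate sequence in $S\times T$, then $\pi_1\circ f$ is an adequate sequence in $S$ and $\pi_2\circ f$ is an adequate sequence in $T$. (3) If $f$ is an adequate sequence in $S$, $g$ is an adequate sequence in $T$, and $h:\mathbb{N}\to S\times T$ is defined by $h(n)=(f(n),g(n))$, then $h$ is an adequate sequence in $S\times T$.
   Context: A partial semigroup is a pair $(S,*)$ where $S$ is a nonempty set and $*$ is an operation defined on a nonempty subset of $S\times S$ such that for all $x,y,z\in S$, $(x*y)*z=x*(y*z)$ in the sense that if either side is defined then so is the other and they are equal. The product $S\times T$ of partial semigroups has operation $(a,b)*(c,d)=(a*c,b*d)$, defined if and only if $a*c$ is defined in $S$ and $b*d$ is defined in $T$; $\pi_1,\pi_2$ are the coordinate projections. For $a\in S$, $\varphi(a)=\{b\in S: a*b \text{ is defined}\}$; for finite nonempty $F\subseteq S$, $\sigma(F)=\bigcap_{a\in F}\varphi(a)$. A partial semigroup is adequate if $\sigma(F)\neq\emptyset$ for all finite nonempty $F$. $\mathcal{P}_f(X)$ denotes the set of finite nonempty subsets of $X$; products $\prod_{t\in H}f(t)$ are computed in increasing order of indices. In an adequate partial semigroup $S$, a sequence $f:\mathbb{N}\to S$ is adequate if (i) for each $H\in\mathcal{P}_f(\mathbb{N})$, $\prod_{t\in H}f(t)$ is defined, and (ii) for each $F\in\mathcal{P}_f(S)$ there is $m\in\mathbb{N}$ such that $\prod_{t\in H}f(t)\in\sigma(F)$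 for all $H\in\mathcal{P}_f(\mathbb{N})$ with $\min H\geq m$. -}

module Defs where

open import Level using (Level; _⊔_)
open import Data.Nat using (ℕ; _≤_; _<_)
open import Data.Product using (Σ; ∃; _×_; _,_; proj₁; proj₂)
open import Data.Maybe using (Maybe; just; nothing; _>>=_)
open import Data.List using (List; []; _∷_)
open import Data.List.NonEmpty using (List⁺; _∷_; toList) renaming (map to map⁺)
open import Data.List.Relation.Unary.All using (All)
open import Data.List.Relation.Unary.Linked using (Linked)
open import Relation.Binary.PropositionalEquality using (_≡_; refl; cong₂)

-- A partial operation is modelled as  S → S → Maybe S  ("nothing" = undefined).
Defined : ∀ {a} {A : Set a} → Maybe A → Set a
Defined {A = A} m = ∃ λ (c : A) → m ≡ just c

record PartialSemigroup (a : Level) : Set (Level.suc a) where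
  field
    Carrier : Set a
    _*_     : Carrier → Carrier → Maybe Carrier
    domain-nonempty : ∃ λ x → ∃ λ y → Defined (x * y)
    -- (x*y)*z = x*(y*z) in the Kleene sense: either side defined iff the other is, and then equal
    assoc : ∀ x y z → ((x * y) >>= λ w → w * z) ≡ ((y * z) >>= λ w → x * w)

open PartialSemigroup public

pairM : ∀ {a b} {A : Set a} {B : Set b} → Maybe A → Maybe B → Maybe (A × B)
pairM (just x) (just y) = just (x , y)
pairM _        _        = nothing

private
  pairM-nothingʳ : ∀ {a b} {A : Set a} {B : Set b} (m : Maybe A) → pairM {B = B} m nothing ≡ nothing
  pairM-nothingʳ (just _) = refl
  pairM-nothingʳ nothing  = refl

  pairM-bind : ∀ {a b} {A : Set a} {B : Set b} (m : Maybe A) (n : Maybe B)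
               (f : A → Maybe A) (g : B → Maybe B) →
               (pairM m n >>= λ w → pairM (f (proj₁ w)) (g (proj₂ w))) ≡ pairM (m >>= f) (n >>= g)
  pairM-bind (just x) (just y) f g = refl
  pairM-bind (just x) nothing  f g = Relation.Binary.PropositionalEquality.sym (pairM-nothingʳ (f x))
  pairM-bind nothing  n        f g = refl


_×ₚ_ : ∀ {a b} → PartialSemigroup a → PartialSemigroup b → PartialSemigroup (a ⊔ b)
S ×ₚ T = record
  { Carrier = Carrier S × Carrier T
  ; _*_ = λ p q → pairM (_*_ S (proj₁ p) (proj₁ q)) (_*_ T (proj₂ p) (proj₂ q))
  ; domain-nonempty = dn (domain-nonempty S) (domain-nonempty T)
  ; assoc = λ x y z → Relation.Binary.PropositionalEquality.trans
      (pairM-bind (_*_ S (proj₁ x) (proj₁ y)) (_*_ T (proj₂ x) (proj₂ y))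
                  (λ w → _*_ S w (proj₁ z)) (λ w → _*_ T w (proj₂ z)))
      (Relation.Binary.PropositionalEquality.trans
        (cong₂ pairM (assoc S (proj₁ x) (proj₁ y) (proj₁ z)) (assoc T (proj₂ x) (proj₂ y) (proj₂ z)))
        (Relation.Binary.PropositionalEquality.sym
          (pairM-bind (_*_ S (proj₁ y) (proj₁ z)) (_*_ T (proj₂ y) (proj₂ z))
                      (λ w → _*_ S (proj₁ x) w) (λ w → _*_ T (proj₂ x) w))))
  }
  where
  dn : (∃ λ x → ∃ λ y → Defined (_*_ S x y)) → (∃ λ x → ∃ λ y → Defined (_*_ T x y)) →
       ∃ λ (x : Carrier S × Carrier T) → ∃ λ y →
         Defined (pairM (_*_ S (proj₁ x) (proj₁ y)) (_*_ T (proj₂ x) (proj₂ y)))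
  dn (x , y , c , e) (x' , y' , c' , e') = (x , x') , (y , y') , (c , c') , cong₂ pairM e e'

module _ {a} (S : PartialSemigroup a) where
  private
    A = Carrier S

  _∈φ_ : A → A → Set a
  b ∈φ x = Defined (_*_ S x b)

  -- b ∈ σ(F), F a finite nonempty subset of S given by a nonempty list of its elements
  _∈σ_ : A → List⁺ A → Set a
  b ∈σ F = All (λ x → b ∈φ x) (toList F)

  Adequate : Set a
  Adequate = ∀ (F : List⁺ A) → ∃ λ b → b ∈σ F

  -- product of a nonempty list, in the given order (right-nested; any nesting agrees by assoc)
  prod′ : A → List A → Maybe A
  prod′ x []       = just x
  prod′ x (y ∷ ys) = prod′ y ys >>= λ w → _*_ S x w

  prod : List⁺ A → Maybe A
  prod (x ∷ xs) = prod′ x xs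

  -- H ∈ P_f(ℕ), represented as its elements listed in strictly increasing order
  StrictlyIncreasing : List⁺ ℕ → Set
  StrictlyIncreasing H = Linked _<_ (toList H)

  ∏ : (ℕ → A) → List⁺ ℕ → Maybe A
  ∏ f H = prod (map⁺ f H)

  AdequateSeq : (ℕ → A) → Set a
  AdequateSeq f =
    (∀ (H : List⁺ ℕ) → StrictlyIncreasing H → Defined (∏ f H)) ×
    (∀ (F : List⁺ A) → ∃ λ (m : ℕ) →
       ∀ (H : List⁺ ℕ) → StrictlyIncreasing H → All (m ≤_) (toList H) →
       ∀ (s : A) → ∏ f H ≡ just s → s ∈σ F)

{-# OPTIONS --safe #-}
module Submission where

-- Everything is decided coordinatewise: a product in S ×ₚ T is defined exactly when both
-- coordinate products are, and then it is their pair. Hence σ-sets and products of sequences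
-- in S ×ₚ T are computed coordinatewise, which gives the backward direction of (1) and
-- part (3) (taking the larger of the two thresholds). For the forward direction of (1) and
-- for (2), pad a finite F ⊆ S with a fixed element t of T (T is nonempty): any element of
-- σ({(x , t) : x ∈ F}) projects into σ(F).

open import Defs
open import Level using (Level)
open import Data.Nat using (ℕ; _≤_; _⊔_)
open import Data.Nat.Properties using (m≤m⊔n; m≤n⊔m; ≤-trans)
open import Data.Product using (∃; _×_; _,_; proj₁; proj₂)
open import Data.Maybe using (Maybe; just; nothing; _>>=_)
open import Data.Maybe.Properties using (just-injective)
open import Data.List using (List; []; _∷_; map)
open import Data.List.Properties as List using ()
open import Data.List.NonEmpty using (List⁺; _∷_; toList) renaming (map to map⁺)
open import Data.List.Relation.Unary.All as All using (All)
open import Data.List.Relation.Unary.All.Properties as All using ()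
open import Function using (_∘_; _⇔_; mk⇔)
open import Relation.Binary.PropositionalEquality using (_≡_; refl; sym; trans; cong; cong₂; subst)

inhabitant : ∀ {a} (S : PartialSemigroup a) → Carrier S
inhabitant S = proj₁ (domain-nonempty S)

module _ {a b} {A : Set a} {B : Set b} where

  pairM-just⁻ : (m : Maybe A) (n : Maybe B) {x : A} {y : B} →
                pairM m n ≡ just (x , y) → m ≡ just x × n ≡ just y
  pairM-just⁻ (just _) (just _) refl = refl , refl
  pairM-just⁻ (just _) nothing  ()
  pairM-just⁻ nothing  _        ()

  Defined-pairM⁺ : {m : Maybe A} {n : Maybe B} → Defined m → Defined n → Defined (pairM m n)
  Defined-pairM⁺ (x , refl) (y , refl) = (x , y) , refl

  Defined-pairM⁻ : (m : Maybe A) (n : Maybe B) → Defined (pairM m n) → Defined m × Defined n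
  Defined-pairM⁻ m n ((x , y) , eq) = let (eqm , eqn) = pairM-just⁻ m n eq in (x , eqm) , (y , eqn)

  pairM->>= : (m : Maybe A) (n : Maybe B) (f : A → Maybe A) (g : B → Maybe B) →
              (pairM m n >>= λ w → pairM (f (proj₁ w)) (g (proj₂ w))) ≡ pairM (m >>= f) (n >>= g)
  pairM->>= (just x) (just y) f g = refl
  pairM->>= (just x) nothing  f g with f x
  ... | just _  = refl
  ... | nothing = refl
  pairM->>= nothing  n        f g = refl

≤-all-weaken : ∀ {m n} {xs : List ℕ} → m ≤ n → All (n ≤_) xs → All (m ≤_) xs
≤-all-weaken m≤n = All.map (≤-trans m≤n)

-- ι need not be a homomorphism; for a product it pads with a fixed element of the other factor.
module Retraction {a b} (P : PartialSemigroup a) (S : PartialSemigroup b)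
  (π : Carrier P → Carrier S) (ι : Carrier S → Carrier P)
  (π-∈φ-ι : ∀ {p x} → _∈φ_ P p (ι x) → _∈φ_ S (π p) x) where

  π-∈σ-ι : ∀ {p} (F : List⁺ (Carrier S)) → _∈σ_ P p (map⁺ ι F) → _∈σ_ S (π p) F
  π-∈σ-ι (x ∷ xs) p∈σ = All.map π-∈φ-ι (All.map⁻ p∈σ)

  adequate-retract : Adequate P → Adequate S
  adequate-retract adP F = let (p , p∈σ) = adP (map⁺ ι F) in π p , π-∈σ-ι F p∈σ

  adequateSeq-retract :
    (π-∏ : ∀ f H {p} → ∏ P f H ≡ just p → ∏ S (π ∘ f) H ≡ just (π p)) →
    ∀ f → AdequateSeq P f → AdequateSeq S (π ∘ f)
  adequateSeq-retract π-∏ f (defined , eventually-σ) = defined′ , eventually-σ′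
    where
    defined′ : ∀ H → StrictlyIncreasing S H → Defined (∏ S (π ∘ f) H)
    defined′ H inc = let (p , eq) = defined H inc in π p , π-∏ f H eq

    eventually-σ′ : ∀ F → ∃ λ m → ∀ H → StrictlyIncreasing S H → All (m ≤_) (toList H) →
                    ∀ s → ∏ S (π ∘ f) H ≡ just s → _∈σ_ S s F
    eventually-σ′ F with eventually-σ (map⁺ ι F)
    ... | m , ι-threshold = m , λ H inc m≤H s eq →
      let (p , eqP) = defined H inc
          πp≡s      = just-injective (trans (sym (π-∏ f H eqP)) eq)
      in subst (λ s → _∈σ_ S s F) πp≡s (π-∈σ-ι F (ι-threshold H inc m≤H p eqP))

module _ {a b : Level} (S : PartialSemigroup a) (T : PartialSemigroup b) where
  private
    P = S ×ₚ T

  prod′-×ₚ : (p : Carrier P) (xs : List (Carrier P)) →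
    prod′ P p xs ≡ pairM (prod′ S (proj₁ p) (map proj₁ xs)) (prod′ T (proj₂ p) (map proj₂ xs))
  prod′-×ₚ p []       = refl
  prod′-×ₚ p (y ∷ ys) = trans (cong (_>>= _*_ P p) (prod′-×ₚ y ys))
    (pairM->>= (prod′ S (proj₁ y) (map proj₁ ys)) (prod′ T (proj₂ y) (map proj₂ ys))
               (_*_ S (proj₁ p)) (_*_ T (proj₂ p)))

  ∏-×ₚ : (f : ℕ → Carrier P) (H : List⁺ ℕ) →
         ∏ P f H ≡ pairM (∏ S (proj₁ ∘ f) H) (∏ T (proj₂ ∘ f) H)
  ∏-×ₚ f (x ∷ xs) = trans (prod′-×ₚ (f x) (map f xs))
    (cong₂ pairM (cong (prod′ S (proj₁ (f x))) (sym (List.map-∘ xs)))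
                 (cong (prod′ T (proj₂ (f x))) (sym (List.map-∘ xs))))

  ∏-×ₚ-just⁻ : (f : ℕ → Carrier P) (H : List⁺ ℕ) {s : Carrier S} {t : Carrier T} →
               ∏ P f H ≡ just (s , t) → ∏ S (proj₁ ∘ f) H ≡ just s × ∏ T (proj₂ ∘ f) H ≡ just t
  ∏-×ₚ-just⁻ f H eq = pairM-just⁻ (∏ S (proj₁ ∘ f) H) (∏ T (proj₂ ∘ f) H) (trans (sym (∏-×ₚ f H)) eq)

  ∈σ-×ₚ⁺ : ∀ {s t} (F : List⁺ (Carrier P)) →
           _∈σ_ S s (map⁺ proj₁ F) → _∈σ_ T t (map⁺ proj₂ F) → _∈σ_ P (s , t) F
  ∈σ-×ₚ⁺ (x ∷ xs) s∈σ t∈σ = All.zipWith (λ (d , e) → Defined-pairM⁺ d e)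
    (All.map⁻ {xs = toList (x ∷ xs)} s∈σ , All.map⁻ {xs = toList (x ∷ xs)} t∈σ)

  private
    module Proj₁ = Retraction P S proj₁ (_, inhabitant T)
      (λ {p} {x} → proj₁ ∘ Defined-pairM⁻ (_*_ S x (proj₁ p)) (_*_ T (inhabitant T) (proj₂ p)))
    module Proj₂ = Retraction P T proj₂ (inhabitant S ,_)
      (λ {p} {x} → proj₂ ∘ Defined-pairM⁻ (_*_ S (inhabitant S) (proj₁ p)) (_*_ T x (proj₂ p)))

  adequate-proj₁ : Adequate P → Adequate S
  adequate-proj₁ = Proj₁.adequate-retract

  adequate-proj₂ : Adequate P → Adequate T
  adequate-proj₂ = Proj₂.adequate-retract

  adequate-×ₚ⁺ : Adequate S → Adequate T → Adequate P
  adequate-×ₚ⁺ adS adT F =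
    let (s , s∈σ) = adS (map⁺ proj₁ F) ; (t , t∈σ) = adT (map⁺ proj₂ F)
    in (s , t) , ∈σ-×ₚ⁺ F s∈σ t∈σ

  adequateSeq-proj₁ : ∀ f → AdequateSeq P f → AdequateSeq S (proj₁ ∘ f)
  adequateSeq-proj₁ = Proj₁.adequateSeq-retract (λ f H → proj₁ ∘ ∏-×ₚ-just⁻ f H)

  adequateSeq-proj₂ : ∀ f → AdequateSeq P f → AdequateSeq T (proj₂ ∘ f)
  adequateSeq-proj₂ = Proj₂.adequateSeq-retract (λ f H → proj₂ ∘ ∏-×ₚ-just⁻ f H)

  adequateSeq-pair : ∀ f g → AdequateSeq S f → AdequateSeq T g → AdequateSeq P (λ n → f n , g n)
  adequateSeq-pair f g (definedS , eventuallyS) (definedT , eventuallyT) = defined , eventually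
    where
    h : ℕ → Carrier P
    h n = f n , g n

    defined : ∀ H → StrictlyIncreasing P H → Defined (∏ P h H)
    defined H inc = subst Defined (sym (∏-×ₚ h H)) (Defined-pairM⁺ (definedS H inc) (definedT H inc))

    eventually : ∀ F → ∃ λ m → ∀ H → StrictlyIncreasing P H → All (m ≤_) (toList H) →
                 ∀ p → ∏ P h H ≡ just p → _∈σ_ P p F
    eventually F with eventuallyS (map⁺ proj₁ F) | eventuallyT (map⁺ proj₂ F)
    ... | mS , thresholdS | mT , thresholdT = mS ⊔ mT , λ H inc m≤H (s , t) eq →
      let (eqS , eqT) = ∏-×ₚ-just⁻ h H eq
      in ∈σ-×ₚ⁺ F (thresholdS H inc (≤-all-weaken (m≤m⊔n mS mT) m≤H) s eqS)
                  (thresholdT H inc (≤-all-weaken (m≤n⊔m mS mT) m≤H) t eqT)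

lemma4p2 : ∀ {a b : Level} (S : PartialSemigroup a) (T : PartialSemigroup b) →
    (Adequate (S ×ₚ T) ⇔ (Adequate S × Adequate T)) ×
    (∀ (f : ℕ → Carrier (S ×ₚ T)) → Adequate (S ×ₚ T) → AdequateSeq (S ×ₚ T) f →
       AdequateSeq S (proj₁ ∘ f) × AdequateSeq T (proj₂ ∘ f)) ×
    (∀ (f : ℕ → Carrier S) (g : ℕ → Carrier T) → Adequate S → Adequate T →
       AdequateSeq S f → AdequateSeq T g →
       AdequateSeq (S ×ₚ T) (λ n → f n , g n))
lemma4p2 S T =
    mk⇔ (λ adP → adequate-proj₁ S T adP , adequate-proj₂ S T adP)
        (λ (adS , adT) → adequate-×ₚ⁺ S T adS adT)
  , (λ f _ seq → adequateSeq-proj₁ S T f seq , adequateSeq-proj₂ S T f seq)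
  , (λ f g _ _ → adequateSeq-pair S T f g)
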